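{- For any $\mathcal{L}_\tau$-formulas $A^{*}$ and $B^{*}$: $\mathbf{KM}_\tau+A^{*}\vdash B^{*}$ if and only if $\mathbf{Int}_\tau+A^{*}\vdash B^{*}$.
   Context: $\mathcal{L}_\tau$ is the propositional language with a countable set of variables, connectives $\wedge,\vee,\rightarrow,\neg$ and a nullary connective $\tau$; $\mathcal{L}_{\tau\sim}$ extends it by a unary connective $\sim$. $\mathbf{Int}_\tau$ is intuitionistic propositional calculus in $\mathcal{L}_\tau$ (axioms of intuitionistic logic, rules: uniform substitution of $\mathcal{L}_\tau$-formulas and modus ponens). $\mathbf{KM}_\tau$ is the calculus in $\mathcal{L}_{\tau\sim}$ whose axioms are those of intuitionistic logic (in $\mathcal{L}_{\tau\sim}$) plus (a) $\sim p\leftrightarrow(p\rightarrow\tau)\wedge\sim\tau$, (b) $(\sim\tau\rightarrow\tau)\rightarrow\tau$, (c) $\sim\tau\rightarrow(p\vee(p\rightarrow\tau))$, (d) $\tau\rightarrow\sim\tau$, with rules uniform substitution of $\mathcal{L}_{\tau\sim}$-formulas and modus ponens. $S+A\vdash B$ means $B$ is derivable in calculus $S$ using $A$ as an additional premise (to which substitution may be applied). $\alpha\leftrightarrow\beta$ abbreviates $(\alpha\rightarrow\beta)\wedge(\beta\rightarrow\alpha)$. -}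

module Defs where

open import Data.Nat using (ℕ)
open import Data.Product using (_×_)

data FmT : Set where
  var  : ℕ → FmT
  τ    : FmT
  _∧_  : FmT → FmT → FmT
  _∨_  : FmT → FmT → FmT
  _⇒_  : FmT → FmT → FmT
  ¬_   : FmT → FmT

infixr 6 _∧_
infixr 5 _∨_
infixr 4 _⇒_
infix  7 ¬_

data Fm : Set where
  var  : ℕ → Fm
  τ    : Fm
  _∧_  : Fm → Fm → Fm
  _∨_  : Fm → Fm → Fm
  _⇒_  : Fm → Fm → Fm
  ¬_   : Fm → Fm
  ∼_   : Fm → Fm

infix 7 ∼_

emb : FmT → Fm
emb (var n) = var n
emb τ       = τ
emb (a ∧ b) = emb a ∧ emb b
emb (a ∨ b) = emb a ∨ emb b
emb (a ⇒ b) = emb a ⇒ emb b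
emb (¬ a)   = ¬ emb a

substT : (ℕ → FmT) → FmT → FmT
substT σ (var n) = σ n
substT σ τ       = τ
substT σ (a ∧ b) = substT σ a ∧ substT σ b
substT σ (a ∨ b) = substT σ a ∨ substT σ b
substT σ (a ⇒ b) = substT σ a ⇒ substT σ b
substT σ (¬ a)   = ¬ substT σ a

subst : (ℕ → Fm) → Fm → Fm
subst σ (var n) = σ n
subst σ τ       = τ
subst σ (a ∧ b) = subst σ a ∧ subst σ b
subst σ (a ∨ b) = subst σ a ∨ subst σ b
subst σ (a ⇒ b) = subst σ a ⇒ subst σ b
subst σ (¬ a)   = ¬ subst σ a
subst σ (∼ a)   = ∼ subst σ a

-- Axioms of intuitionistic propositional logic (standard Hilbert axioms,
-- with propositional variables p = var 0, q = var 1, r = var 2;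
-- instances are obtained by the substitution rule).

module IntAxioms (F : Set) (v : ℕ → F)
                 (_&_ _∣_ _⊃_ : F → F → F) (neg : F → F) where
  p q r : F
  p = v 0
  q = v 1
  r = v 2

  data IntAx : F → Set where
    ax1  : IntAx (p ⊃ (q ⊃ p))
    ax2  : IntAx ((p ⊃ (q ⊃ r)) ⊃ ((p ⊃ q) ⊃ (p ⊃ r)))
    ax3  : IntAx ((p & q) ⊃ p)
    ax4  : IntAx ((p & q) ⊃ q)
    ax5  : IntAx (p ⊃ (q ⊃ (p & q)))
    ax6  : IntAx (p ⊃ (p ∣ q))
    ax7  : IntAx (q ⊃ (p ∣ q))
    ax8  : IntAx ((p ⊃ r) ⊃ ((q ⊃ r) ⊃ ((p ∣ q) ⊃ r)))
    ax9  : IntAx ((p ⊃ q) ⊃ ((p ⊃ neg q) ⊃ neg p))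
    ax10 : IntAx (neg p ⊃ (p ⊃ q))

open IntAxioms FmT var _∧_ _∨_ _⇒_ ¬_ renaming (IntAx to IntAxT) using ()
open IntAxioms Fm  var _∧_ _∨_ _⇒_ ¬_ renaming (IntAx to IntAxF) using ()

_⟺_ : Fm → Fm → Fm
a ⟺ b = (a ⇒ b) ∧ (b ⇒ a)
infix 3 _⟺_

pF : Fm
pF = var 0

data KMAx : Fm → Set where
  int : ∀ {a} → IntAxF a → KMAx a
  axa : KMAx (∼ pF ⟺ ((pF ⇒ τ) ∧ ∼ τ))
  axb : KMAx ((∼ τ ⇒ τ) ⇒ τ)
  axc : KMAx (∼ τ ⇒ (pF ∨ (pF ⇒ τ)))
  axd : KMAx (τ ⇒ ∼ τ)

-- Derivability with an additional premise (treated as an extra axiom,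
-- so substitution may be applied to it and to everything derived).

data _⊢Int_ (A : FmT) : FmT → Set where
  axiom : ∀ {b} → IntAxT b → A ⊢Int b
  prem  : A ⊢Int A
  sub   : ∀ {b} (σ : ℕ → FmT) → A ⊢Int b → A ⊢Int substT σ b
  mp    : ∀ {a b} → A ⊢Int (a ⇒ b) → A ⊢Int a → A ⊢Int b

data _⊢KM_ (A : Fm) : Fm → Set where
  axiom : ∀ {b} → KMAx b → A ⊢KM b
  prem  : A ⊢KM A
  sub   : ∀ {b} (σ : ℕ → Fm) → A ⊢KM b → A ⊢KM subst σ b
  mp    : ∀ {a b} → A ⊢KM (a ⇒ b) → A ⊢KM a → A ⊢KM b

infix 2 _⊢Int_ _⊢KM_

-- Interpret ∼φ as (φ → τ) ∧ S, where S is the conjunction of c° ∨ (c° → τ) over the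
-- finitely many instances c of axiom (c) occurring in a KM_τ derivation (pushed to
-- the leaves, so that these instances are fixed formulas), and c° interprets ∼ with
-- the trivial τ → τ in place of S. Axioms (a), (b), (d) hold under this interpretation
-- for any such S, since τ ⊢ S and ⊢ (S → τ) → τ; axiom (c) holds because S contains
-- its instance and, given S, interpreting ∼ with S or with τ → τ yields equivalent
-- formulas. The interpretation fixes L_τ-formulas, so a KM_τ derivation from A
-- becomes an Int_τ derivation from A.
module Submission where

open import Defs
open import Function.Bundles using (_⇔_; mk⇔)
open import Data.Nat using (ℕ; zero; suc)
open import Data.List using (List; []; _∷_; _++_)
open import Data.List.Membership.Propositional using (_∈_)
open import Data.List.Relation.Unary.Any using (here; there)
open import Data.List.Relation.Binary.Subset.Propositional using (_⊆_)
open import Data.List.Relation.Binary.Subset.Propositional.Properties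
  using (⊆-refl; ⊆-trans; xs⊆xs++ys; xs⊆ys++xs)
open import Data.Product using (_×_; _,_; proj₁; proj₂; ∃-syntax)
open import Relation.Binary.PropositionalEquality
  using (_≡_; refl; cong; cong₂; sym) renaming (subst to transport)

module IT = IntAxioms FmT var _∧_ _∨_ _⇒_ ¬_
module IF = IntAxioms Fm var _∧_ _∨_ _⇒_ ¬_

emb-substT : ∀ (σ : ℕ → FmT) b → emb (substT σ b) ≡ subst (λ n → emb (σ n)) (emb b)
emb-substT σ (var n) = refl
emb-substT σ τ       = refl
emb-substT σ (a ∧ b) = cong₂ _∧_ (emb-substT σ a) (emb-substT σ b)
emb-substT σ (a ∨ b) = cong₂ _∨_ (emb-substT σ a) (emb-substT σ b)
emb-substT σ (a ⇒ b) = cong₂ _⇒_ (emb-substT σ a) (emb-substT σ b)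
emb-substT σ (¬ a)   = cong ¬_ (emb-substT σ a)

subst-∘ : ∀ (σ ρ : ℕ → Fm) b → subst σ (subst ρ b) ≡ subst (λ n → subst σ (ρ n)) b
subst-∘ σ ρ (var n) = refl
subst-∘ σ ρ τ       = refl
subst-∘ σ ρ (a ∧ b) = cong₂ _∧_ (subst-∘ σ ρ a) (subst-∘ σ ρ b)
subst-∘ σ ρ (a ∨ b) = cong₂ _∨_ (subst-∘ σ ρ a) (subst-∘ σ ρ b)
subst-∘ σ ρ (a ⇒ b) = cong₂ _⇒_ (subst-∘ σ ρ a) (subst-∘ σ ρ b)
subst-∘ σ ρ (¬ a)   = cong ¬_ (subst-∘ σ ρ a)
subst-∘ σ ρ (∼ a)   = cong ∼_ (subst-∘ σ ρ a)

subst-var : ∀ b → subst var b ≡ b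
subst-var (var n) = refl
subst-var τ       = refl
subst-var (a ∧ b) = cong₂ _∧_ (subst-var a) (subst-var b)
subst-var (a ∨ b) = cong₂ _∨_ (subst-var a) (subst-var b)
subst-var (a ⇒ b) = cong₂ _⇒_ (subst-var a) (subst-var b)
subst-var (¬ a)   = cong ¬_ (subst-var a)
subst-var (∼ a)   = cong ∼_ (subst-var a)

emb-IntAx : ∀ {b} → IT.IntAx b → IF.IntAx (emb b)
emb-IntAx IT.ax1  = IF.ax1
emb-IntAx IT.ax2  = IF.ax2
emb-IntAx IT.ax3  = IF.ax3
emb-IntAx IT.ax4  = IF.ax4
emb-IntAx IT.ax5  = IF.ax5
emb-IntAx IT.ax6  = IF.ax6
emb-IntAx IT.ax7  = IF.ax7
emb-IntAx IT.ax8  = IF.ax8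
emb-IntAx IT.ax9  = IF.ax9
emb-IntAx IT.ax10 = IF.ax10

IntAx-emb⁻¹ : ∀ {b} → IF.IntAx b → ∃[ b′ ] IT.IntAx b′ × emb b′ ≡ b
IntAx-emb⁻¹ IF.ax1  = _ , IT.ax1  , refl
IntAx-emb⁻¹ IF.ax2  = _ , IT.ax2  , refl
IntAx-emb⁻¹ IF.ax3  = _ , IT.ax3  , refl
IntAx-emb⁻¹ IF.ax4  = _ , IT.ax4  , refl
IntAx-emb⁻¹ IF.ax5  = _ , IT.ax5  , refl
IntAx-emb⁻¹ IF.ax6  = _ , IT.ax6  , refl
IntAx-emb⁻¹ IF.ax7  = _ , IT.ax7  , refl
IntAx-emb⁻¹ IF.ax8  = _ , IT.ax8  , refl
IntAx-emb⁻¹ IF.ax9  = _ , IT.ax9  , refl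
IntAx-emb⁻¹ IF.ax10 = _ , IT.ax10 , refl

emb-⊢ : ∀ {A b} → A ⊢Int b → emb A ⊢KM emb b
emb-⊢ (axiom k)       = axiom (int (emb-IntAx k))
emb-⊢ prem            = prem
emb-⊢ {A} (sub {b} σ d) =
  transport (emb A ⊢KM_) (sym (emb-substT σ b)) (sub (λ n → emb (σ n)) (emb-⊢ d))
emb-⊢ (mp d e)        = mp (emb-⊢ d) (emb-⊢ e)


data NormalKM (A : Fm) : Fm → Set where
  axiom : ∀ {b} → KMAx b → (σ : ℕ → Fm) → NormalKM A (subst σ b)
  prem  : (σ : ℕ → Fm) → NormalKM A (subst σ A)
  mp    : ∀ {a b} → NormalKM A (a ⇒ b) → NormalKM A a → NormalKM A b

normalise : ∀ {A b} → A ⊢KM b → (σ : ℕ → Fm) → NormalKM A (subst σ b)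
normalise (axiom k)         σ = axiom k σ
normalise prem              σ = prem σ
normalise {A} (sub {b} ρ d) σ =
  transport (NormalKM A) (sym (subst-∘ σ ρ b)) (normalise d (λ n → subst σ (ρ n)))
normalise (mp d e)          σ = mp (normalise d σ) (normalise e σ)

-- The instance of axiom (c) at σ is σ 0 ∨ (σ 0 → τ); only σ 0 is recorded.
axc-instances : ∀ {A b} → NormalKM A b → List Fm
axc-instances (axiom axc σ) = σ 0 ∷ []
axc-instances (axiom _ _)   = []
axc-instances (prem _)      = []
axc-instances (mp d e)      = axc-instances d ++ axc-instances e

translate : FmT → Fm → FmT
translate S (var n) = var n
translate S τ       = τ
translate S (a ∧ b) = translate S a ∧ translate S b
translate S (a ∨ b) = translate S a ∨ translate S b
translate S (a ⇒ b) = translate S a ⇒ translate S b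
translate S (¬ a)   = ¬ translate S a
translate S (∼ a)   = (translate S a ⇒ τ) ∧ S

translate-emb : ∀ S b → translate S (emb b) ≡ b
translate-emb S (var n) = refl
translate-emb S τ       = refl
translate-emb S (a ∧ b) = cong₂ _∧_ (translate-emb S a) (translate-emb S b)
translate-emb S (a ∨ b) = cong₂ _∨_ (translate-emb S a) (translate-emb S b)
translate-emb S (a ⇒ b) = cong₂ _⇒_ (translate-emb S a) (translate-emb S b)
translate-emb S (¬ a)   = cong ¬_ (translate-emb S a)

translate-subst-emb : ∀ S σ b →
  translate S (subst σ (emb b)) ≡ substT (λ n → translate S (σ n)) b
translate-subst-emb S σ (var n) = refl
translate-subst-emb S σ τ       = refl
translate-subst-emb S σ (a ∧ b) = cong₂ _∧_ (translate-subst-emb S σ a) (translate-subst-emb S σ b)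
translate-subst-emb S σ (a ∨ b) = cong₂ _∨_ (translate-subst-emb S σ a) (translate-subst-emb S σ b)
translate-subst-emb S σ (a ⇒ b) = cong₂ _⇒_ (translate-subst-emb S σ a) (translate-subst-emb S σ b)
translate-subst-emb S σ (¬ a)   = cong ¬_ (translate-subst-emb S σ a)

⊤τ : FmT
⊤τ = τ ⇒ τ

τ-excluded-middle : Fm → FmT
τ-excluded-middle c = translate ⊤τ c ∨ (translate ⊤τ c ⇒ τ)

⋀τ-excluded-middle : List Fm → FmT
⋀τ-excluded-middle []      = ⊤τ
⋀τ-excluded-middle (c ∷ L) = τ-excluded-middle c ∧ ⋀τ-excluded-middle L

pqr≔ : FmT → FmT → FmT → ℕ → FmT
pqr≔ a b c zero          = a
pqr≔ a b c (suc zero)    = b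
pqr≔ a b c (suc (suc _)) = c

module NaturalDeduction (A : FmT) where

  instance₃ : ∀ {b} (p q r : FmT) → IT.IntAx b → A ⊢Int substT (pqr≔ p q r) b
  instance₃ p q r k = sub (pqr≔ p q r) (axiom k)

  ⇒-const : ∀ a b → A ⊢Int (a ⇒ b ⇒ a)
  ⇒-const a b = instance₃ a b a IT.ax1

  ⇒-dist : ∀ a b c → A ⊢Int ((a ⇒ b ⇒ c) ⇒ (a ⇒ b) ⇒ a ⇒ c)
  ⇒-dist a b c = instance₃ a b c IT.ax2

  ⇒-refl : ∀ a → A ⊢Int (a ⇒ a)
  ⇒-refl a = mp (mp (⇒-dist a (a ⇒ a) a) (⇒-const a (a ⇒ a))) (⇒-const a a)

  -- Contexts are listed innermost hypothesis first: (x ∷ Γ) ⇛ φ is Γ ⇛ (x ⇒ φ).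
  _⇛_ : List FmT → FmT → FmT
  []      ⇛ φ = φ
  (x ∷ Γ) ⇛ φ = Γ ⇛ (x ⇒ φ)

  ⇛-weaken : ∀ Γ {φ} → A ⊢Int φ → A ⊢Int (Γ ⇛ φ)
  ⇛-weaken []      d = d
  ⇛-weaken (x ∷ Γ) {φ} d = ⇛-weaken Γ (mp (⇒-const φ x) d)

  ⇛-mp : ∀ Γ {a b} → A ⊢Int (Γ ⇛ (a ⇒ b)) → A ⊢Int (Γ ⇛ a) → A ⊢Int (Γ ⇛ b)
  ⇛-mp []      d e = mp d e
  ⇛-mp (x ∷ Γ) {a} {b} d e = ⇛-mp Γ (⇛-mp Γ (⇛-weaken Γ (⇒-dist x a b)) d) e

  record _⊩_ (Γ : List FmT) (φ : FmT) : Set where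
    constructor ⟨_⟩
    field derivation : A ⊢Int (Γ ⇛ φ)
  open _⊩_ public
  infix 1 _⊩_

  theorem : ∀ {Γ φ} → A ⊢Int φ → Γ ⊩ φ
  theorem {Γ} d = ⟨ ⇛-weaken Γ d ⟩

  app : ∀ {Γ a b} → Γ ⊩ (a ⇒ b) → Γ ⊩ a → Γ ⊩ b
  app {Γ} ⟨ d ⟩ ⟨ e ⟩ = ⟨ ⇛-mp Γ d e ⟩

  lam : ∀ {Γ a b} → (a ∷ Γ) ⊩ b → Γ ⊩ (a ⇒ b)
  lam ⟨ d ⟩ = ⟨ d ⟩

  wk : ∀ {Γ x φ} → Γ ⊩ φ → (x ∷ Γ) ⊩ φ
  wk {Γ} {x} {φ} ⟨ d ⟩ = ⟨ ⇛-mp Γ (⇛-weaken Γ (⇒-const φ x)) d ⟩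

  v0 : ∀ {Γ x} → (x ∷ Γ) ⊩ x
  v0 {Γ} {x} = ⟨ ⇛-weaken Γ (⇒-refl x) ⟩

  v1 : ∀ {Γ x y} → (y ∷ x ∷ Γ) ⊩ x
  v1 = wk v0

  v2 : ∀ {Γ x y z} → (z ∷ y ∷ x ∷ Γ) ⊩ x
  v2 = wk v1

  ∧-intro : ∀ {Γ a b} → Γ ⊩ a → Γ ⊩ b → Γ ⊩ (a ∧ b)
  ∧-intro {a = a} {b} d e = app (app (theorem (instance₃ a b a IT.ax5)) d) e

  ∧-elimˡ : ∀ {Γ a b} → Γ ⊩ (a ∧ b) → Γ ⊩ a
  ∧-elimˡ {a = a} {b} = app (theorem (instance₃ a b a IT.ax3))

  ∧-elimʳ : ∀ {Γ a b} → Γ ⊩ (a ∧ b) → Γ ⊩ b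
  ∧-elimʳ {a = a} {b} = app (theorem (instance₃ a b a IT.ax4))

  ∨-introˡ : ∀ {Γ a b} → Γ ⊩ a → Γ ⊩ (a ∨ b)
  ∨-introˡ {a = a} {b} = app (theorem (instance₃ a b a IT.ax6))

  ∨-introʳ : ∀ {Γ a b} → Γ ⊩ b → Γ ⊩ (a ∨ b)
  ∨-introʳ {a = a} {b} = app (theorem (instance₃ a b a IT.ax7))

  ∨-elim : ∀ {Γ a b c} → Γ ⊩ (a ⇒ c) → Γ ⊩ (b ⇒ c) → Γ ⊩ (a ∨ b) → Γ ⊩ c
  ∨-elim {a = a} {b} {c} f g = app (app (app (theorem (instance₃ a b c IT.ax8)) f) g)

  ¬-intro : ∀ {Γ a b} → Γ ⊩ (a ⇒ b) → Γ ⊩ (a ⇒ ¬ b) → Γ ⊩ ¬ a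
  ¬-intro {a = a} {b} f g = app (app (theorem (instance₃ a b a IT.ax9)) f) g

  translate-⇔ : ∀ {Γ S S′} → Γ ⊩ (S ⇒ S′) → Γ ⊩ (S′ ⇒ S) →
    ∀ c → (Γ ⊩ (translate S c ⇒ translate S′ c)) × (Γ ⊩ (translate S′ c ⇒ translate S c))
  translate-⇔ s s′ (var n) = lam v0 , lam v0
  translate-⇔ s s′ τ       = lam v0 , lam v0
  translate-⇔ s s′ (a ∧ b) with translate-⇔ s s′ a | translate-⇔ s s′ b
  ... | fa , ga | fb , gb =
    lam (∧-intro (app (wk fa) (∧-elimˡ v0)) (app (wk fb) (∧-elimʳ v0))) ,
    lam (∧-intro (app (wk ga) (∧-elimˡ v0)) (app (wk gb) (∧-elimʳ v0)))
  translate-⇔ s s′ (a ∨ b) with translate-⇔ s s′ a | translate-⇔ s s′ b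
  ... | fa , ga | fb , gb =
    lam (∨-elim (lam (∨-introˡ (app (wk (wk fa)) v0))) (lam (∨-introʳ (app (wk (wk fb)) v0))) v0) ,
    lam (∨-elim (lam (∨-introˡ (app (wk (wk ga)) v0))) (lam (∨-introʳ (app (wk (wk gb)) v0))) v0)
  translate-⇔ s s′ (a ⇒ b) with translate-⇔ s s′ a | translate-⇔ s s′ b
  ... | fa , ga | fb , gb =
    lam (lam (app (wk (wk fb)) (app v1 (app (wk (wk ga)) v0)))) ,
    lam (lam (app (wk (wk gb)) (app v1 (app (wk (wk fa)) v0))))
  translate-⇔ s s′ (¬ a) with translate-⇔ s s′ a
  ... | fa , ga = lam (¬-intro (wk ga) (lam v1)) , lam (¬-intro (wk fa) (lam v1))
  translate-⇔ s s′ (∼ a) with translate-⇔ s s′ a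
  ... | fa , ga =
    lam (∧-intro (lam (app (∧-elimˡ v1) (app (wk (wk ga)) v0))) (app (wk s) (∧-elimʳ v0))) ,
    lam (∧-intro (lam (app (∧-elimˡ v1) (app (wk (wk fa)) v0))) (app (wk s′) (∧-elimʳ v0)))

  ⋀-lookup : ∀ {Γ c L} → c ∈ L → Γ ⊩ ⋀τ-excluded-middle L → Γ ⊩ τ-excluded-middle c
  ⋀-lookup (here refl) s = ∧-elimˡ s
  ⋀-lookup (there c∈L) s = ⋀-lookup c∈L (∧-elimʳ s)

  ¬τ¬τ-⋀ : ∀ {Γ} L → Γ ⊩ ((⋀τ-excluded-middle L ⇒ τ) ⇒ τ)
  ¬τ¬τ-⋀ []      = lam (app v0 (lam v0))
  ¬τ¬τ-⋀ (c ∷ L) = lam (app (¬τ¬τ-⋀ L) (lam (app ¬τ¬τ-excluded (lam (app v2 (∧-intro v0 v1))))))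
    where
    ¬τ¬τ-excluded : ∀ {Γ} → Γ ⊩ ((τ-excluded-middle c ⇒ τ) ⇒ τ)
    ¬τ¬τ-excluded = lam (app v0 (∨-introʳ (lam (app v1 (∨-introˡ v0)))))

  τ⇒⋀ : ∀ {Γ} L → Γ ⊩ τ → Γ ⊩ ⋀τ-excluded-middle L
  τ⇒⋀ []      t = lam v0
  τ⇒⋀ (c ∷ L) t = ∧-intro (∨-introʳ (lam (wk t))) (τ⇒⋀ L t)

  translate-emb-instance : ∀ S σ {b} → A ⊢Int b → A ⊢Int translate S (subst σ (emb b))
  translate-emb-instance S σ {b} d =
    transport (A ⊢Int_) (sym (translate-subst-emb S σ b)) (sub (λ n → translate S (σ n)) d)

  translate-sound : ∀ L {φ} (d : NormalKM (emb A) φ) → axc-instances d ⊆ L →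
    A ⊢Int translate (⋀τ-excluded-middle L) φ
  translate-sound L (axiom (int k) σ) _ with IntAx-emb⁻¹ k
  ... | _ , k′ , refl = translate-emb-instance _ σ (axiom k′)
  translate-sound L (axiom axa σ) _ = derivation {[]}
    (∧-intro (lam (∧-intro (∧-elimˡ v0) (∧-intro (lam v0) (∧-elimʳ v0))))
             (lam (∧-intro (∧-elimˡ v0) (∧-elimʳ (∧-elimʳ v0)))))
  translate-sound L (axiom axb σ) _ = derivation {[]}
    (lam (app (¬τ¬τ-⋀ L) (lam (app v1 (∧-intro (lam v0) v0)))))
  translate-sound L (axiom axc σ) ⊆L = derivation {[]}
    (lam (∨-elim (lam (∨-introˡ (app (wk (proj₂ S⇔⊤τ)) v0)))
                 (lam (∨-introʳ (lam (app v1 (app (wk (wk (proj₁ S⇔⊤τ))) v0)))))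
                 (⋀-lookup (⊆L (here refl)) (∧-elimʳ v0))))
    where
    S : FmT
    S = ⋀τ-excluded-middle L
    S⇔⊤τ : (((⊤τ ∧ S) ∷ []) ⊩ (translate S (σ 0) ⇒ translate ⊤τ (σ 0)))
         × (((⊤τ ∧ S) ∷ []) ⊩ (translate ⊤τ (σ 0) ⇒ translate S (σ 0)))
    S⇔⊤τ = translate-⇔ (lam (lam v0)) (lam (∧-elimʳ v1)) (σ 0)
  translate-sound L (axiom axd σ) _ = derivation {[]} (lam (∧-intro (lam v0) (τ⇒⋀ L v0)))
  translate-sound L (prem σ) _ = translate-emb-instance _ σ prem
  translate-sound L (mp d e) ⊆L =
    mp (translate-sound L d (⊆-trans (xs⊆xs++ys _ _) ⊆L))
       (translate-sound L e (⊆-trans (xs⊆ys++xs _ _) ⊆L))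

propositionP : (A B : FmT) → (emb A ⊢KM emb B) ⇔ (A ⊢Int B)
propositionP A B = mk⇔ KM⇒Int emb-⊢
  where
  open NaturalDeduction A using (translate-sound)
  KM⇒Int : emb A ⊢KM emb B → A ⊢Int B
  KM⇒Int d = transport (A ⊢Int_) (translate-emb _ B) (translate-sound _ normal ⊆-refl)
    where
    normal : NormalKM (emb A) (emb B)
    normal = transport (NormalKM (emb A)) (subst-var (emb B)) (normalise d var)
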